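{- Let $k$ be a finite field of odd cardinality $q$. The sign maps $\mathrm{sgn}:\Sigma_{q^{r}}^{*}\rightarrow\{\pm 1\}$, $r\geq0$, are compatible with the transition maps $i_{r}$ and induce an isomorphism $K_{1}(\mathcal{S}_{q^{\infty}}^{*})\simeq \mathbf{Z}/2\mathbf{Z}$.
   Context: $\Sigma^*_{q^r}$ is the group of bijections $\sigma:k^r\to k^r$ with $\sigma(0)=0$, and $\mathrm{sgn}(\sigma)$ is the sign of $\sigma$ as a permutation of $k^r$. The map $i_r:\Sigma^*_{q^r}\to\Sigma^*_{q^{r+1}}$ sends $\sigma$ to $\sigma\times\mathrm{Id}:k^r\times k\to k^r\times k$, and $\Sigma^*_{q^\infty}=\varinjlim_r\Sigma^*_{q^r}$. $K_1(\mathcal{S}^*_{q^\infty})=\pi_1(B(\Sigma^*_{q^\infty})^+)$, where the Quillen plus construction is taken with respect to the (perfect) commutator subgroup of $\Sigma^*_{q^\infty}$; thus $K_1(\mathcal{S}^*_{q^\infty})$ is the abelianisation of $\Sigma^*_{q^\infty}$. -}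

module Defs where

open import Level using (0ℓ)
open import Algebra.Bundles using (CommutativeRing)
open import Data.Nat using (ℕ; zero; suc; _+_; _%_; _<ᵇ_; _≡ᵇ_)
open import Data.Fin using (Fin)
import Data.Fin.Properties as FinP
open import Data.Bool using (Bool; true; false; if_then_else_)
open import Data.List as L using (List; []; _∷_; length; filter; concatMap; allFin)
open import Data.Vec as V using (Vec; []; _∷_; _∷ʳ_; init; last; replicate)
import Data.Vec.Properties as VP
open import Data.Product using (Σ; _×_; _,_; ∃; proj₁; proj₂)
open import Data.Sign using (Sign) renaming (+ to plus; - to minus)
open import Function.Bundles using (_↔_; Inverse; mk↔ₛ′)
open import Function.Construct.Composition using (_↔-∘_)
open import Function.Construct.Identity using (↔-id)
open import Function.Construct.Symmetry using (↔-sym)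
open import Relation.Nullary using (¬_; yes; no; Dec)
open import Relation.Binary.Definitions using (DecidableEquality)
open import Relation.Binary.PropositionalEquality
  using (_≡_; refl; sym; trans; cong; cong₂)

record FiniteField (q : ℕ) : Set₁ where
  field
    commRing : CommutativeRing 0ℓ 0ℓ
  open CommutativeRing commRing public
  field
    ≈⇒≡      : ∀ {x y} → x ≈ y → x ≡ y
    0≢1      : ¬ (0# ≈ 1#)
    inverses : ∀ x → ¬ (x ≈ 0#) → Σ Carrier λ y → (x * y) ≈ 1#
    card     : Carrier ↔ Fin q

module _ {q : ℕ} (k : FiniteField q) where
  open FiniteField k using (Carrier; 0#; card)

  _≟k_ : DecidableEquality Carrier
  x ≟k y with Inverse.to card x FinP.≟ Inverse.to card y
  ... | yes p = yes (trans (sym (Inverse.strictlyInverseʳ card x))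
                    (trans (cong (Inverse.from card) p) (Inverse.strictlyInverseʳ card y)))
  ... | no ¬p = no λ e → ¬p (cong (Inverse.to card) e)

  Kr : ℕ → Set
  Kr r = Vec Carrier r

  zeroV : ∀ r → Kr r
  zeroV r = replicate r 0#

  record Σ* (r : ℕ) : Set where
    field
      perm : Kr r ↔ Kr r
      fix0 : Inverse.to perm (zeroV r) ≡ zeroV r
  open Σ* public

  app : ∀ {r} → Σ* r → Kr r → Kr r
  app σ = Inverse.to (perm σ)

  _∘*_ : ∀ {r} → Σ* r → Σ* r → Σ* r
  σ ∘* τ = record { perm = perm σ ↔-∘ perm τ
                  ; fix0 = trans (cong (app σ) (fix0 τ)) (fix0 σ) }

  id* : ∀ {r} → Σ* r
  id* = record { perm = ↔-id _ ; fix0 = refl }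

  inv* : ∀ {r} → Σ* r → Σ* r
  inv* {r} σ = record
    { perm = ↔-sym (perm σ)
    ; fix0 = trans (cong (Inverse.from (perm σ)) (sym (fix0 σ)))
                   (Inverse.strictlyInverseʳ (perm σ) (zeroV r)) }

  _≈*_ : ∀ {r} → Σ* r → Σ* r → Set
  σ ≈* τ = ∀ x → app σ x ≡ app τ x

  comm* : ∀ {r} → Σ* r → Σ* r → Σ* r
  comm* a b = a ∘* (b ∘* (inv* a ∘* inv* b))

  prodComm : ∀ {r} → List (Σ* r × Σ* r) → Σ* r
  prodComm []            = id*
  prodComm ((a , b) ∷ l) = comm* a b ∘* prodComm l

  -- transition maps i_r : σ ↦ σ × Id, with k^{r+1} = k^r × k
  -- (the last coordinate is the new factor k)

  private
    split-join : ∀ {r} (w : Kr (suc r)) → init w ∷ʳ last w ≡ w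
    split-join {zero}  (x ∷ []) = refl
    split-join {suc r} (x ∷ w)  =
      trans (cong₂ _∷ʳ_ (initTail x w) (lastTail x w)) (cong (x ∷_) (split-join w))
      where
      initTail : ∀ {n} (x : Carrier) (w : Kr (suc n)) → init (x ∷ w) ≡ x ∷ init w
      initTail x w with V.initLast w
      ... | ys , y , refl = refl
      lastTail : ∀ {n} (x : Carrier) (w : Kr (suc n)) → last (x ∷ w) ≡ last w
      lastTail x (y ∷ w) = refl

    replicate-∷ʳ : ∀ r → zeroV r ∷ʳ 0# ≡ zeroV (suc r)
    replicate-∷ʳ zero    = refl
    replicate-∷ʳ (suc r) = cong (0# ∷_) (replicate-∷ʳ r)

    timesId : ∀ {r} → (Kr r → Kr r) → Kr (suc r) → Kr (suc r)
    timesId f w = f (init w) ∷ʳ last w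

  i : ∀ r → Σ* r → Σ* (suc r)
  i r σ = record
    { perm = mk↔ₛ′ (timesId (app σ)) (timesId (Inverse.from (perm σ))) invR invL
    ; fix0 = trans (cong (λ w → app σ (init w) ∷ʳ last w) (sym (replicate-∷ʳ r)))
             (trans (cong₂ (λ a b → app σ a ∷ʳ b) (VP.init-∷ʳ 0# (zeroV r)) (VP.last-∷ʳ 0# (zeroV r)))
             (trans (cong (_∷ʳ 0#) (fix0 σ)) (replicate-∷ʳ r))) }
    where
    invR : ∀ w → timesId (app σ) (timesId (Inverse.from (perm σ)) w) ≡ w
    invR w = trans (cong₂ (λ a b → app σ a ∷ʳ b)
                     (VP.init-∷ʳ (last w) (Inverse.from (perm σ) (init w))) (VP.last-∷ʳ (last w) (Inverse.from (perm σ) (init w))))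
             (trans (cong (_∷ʳ last w) (Inverse.strictlyInverseˡ (perm σ) (init w)))
                    (split-join w))
    invL : ∀ w → timesId (Inverse.from (perm σ)) (timesId (app σ) w) ≡ w
    invL w = trans (cong₂ (λ a b → Inverse.from (perm σ) a ∷ʳ b)
                     (VP.init-∷ʳ (last w) (app σ (init w))) (VP.last-∷ʳ (last w) (app σ (init w))))
             (trans (cong (_∷ʳ last w) (Inverse.strictlyInverseʳ (perm σ) (init w)))
                    (split-join w))

  lift : ∀ n {r} → Σ* r → Σ* (n + r)
  lift zero    σ = σ
  lift (suc n) σ = i _ (lift n σ)

  allK : List Carrier
  allK = L.map (Inverse.from card) (allFin q)

  allVecs : ∀ r → List (Kr r)
  allVecs zero    = [] ∷ []
  allVecs (suc r) = concatMap (λ x → L.map (x ∷_) (allVecs r)) allK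

  index : ∀ {r} → List (Kr r) → Kr r → ℕ
  index []       v = 0
  index (x ∷ xs) v with VP.≡-dec _≟k_ x v
  ... | yes _ = 0
  ... | no  _ = suc (index xs v)

  orderedPairs : ∀ {A : Set} → List A → List (A × A)
  orderedPairs []       = []
  orderedPairs (x ∷ xs) = L.map (x ,_) xs L.++ orderedPairs xs

  inversions : ∀ {r} → Σ* r → ℕ
  inversions {r} σ = length (L.filterᵇ isInv (orderedPairs (allVecs r)))
    where
    pos = index (allVecs r)
    isInv : Kr r × Kr r → Bool
    isInv (a , b) = pos (app σ b) <ᵇ pos (app σ a)

  parity : ℕ → Sign
  parity n = if (n % 2 ≡ᵇ 0) then plus else minus

  sgn : ∀ {r} → Σ* r → Sign
  sgn σ = parity (inversions σ)

{-# OPTIONS --safe #-}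
-- The number of
-- inversions of f is half the number of ordered pairs whose relative order f changes, and in that form
-- it can be reindexed along a bijection g; this gives sgn (f ∘ g) = sgn f · sgn g.  The new factor of
-- k^{r+1} = k^r × k is the least significant digit of the enumeration, so σ × Id changes the order of
-- two vectors exactly when σ changes the order of their k^r-parts; hence σ × Id has q² times as many
-- inversions as σ, and q is odd.  All transpositions are conjugate and the one exchanging the first two
-- elements has a single inversion, so every transposition is odd; as q ≥ 3, k contains two distinct
-- nonzero elements to exchange.  Finally, a permutation fixing 0 is a product of transpositions of
-- nonzero vectors, an even one of an even number of them, and (a b)(c d) = [(a b), g] for any g
-- fixing 0 with g a = c and g b = d.
module Submission where

module NatLemmas where

  open import Data.Bool using (true; false)
  open import Data.Empty using (⊥-elim)
  open import Data.Nat using (zero; suc; _+_; _*_; _%_; _<_; _≤_; _<ᵇ_; z≤n; s≤s)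
  open import Data.Nat.Properties using (<-cmp; <⇒≤; +-monoʳ-<; +-comm; *-monoˡ-≤; m≤m+n; module ≤-Reasoning)
  open import Relation.Binary.Definitions using (tri<; tri≈; tri>)
  open import Relation.Binary.PropositionalEquality using (_≡_; _≢_; refl; sym; trans)

  <ᵇ-true : ∀ {m n} → m < n → (m <ᵇ n) ≡ true
  <ᵇ-true {zero}  {suc n} _         = refl
  <ᵇ-true {suc m} {suc n} (s≤s m<n) = <ᵇ-true m<n

  <ᵇ-false : ∀ {m n} → n ≤ m → (m <ᵇ n) ≡ false
  <ᵇ-false {m}     {zero}  _         = refl
  <ᵇ-false {suc m} {suc n} (s≤s n≤m) = <ᵇ-false n≤m

  <ᵇ-+ˡ : ∀ m {s t} → (m + t <ᵇ m + s) ≡ (t <ᵇ s)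
  <ᵇ-+ˡ zero    = refl
  <ᵇ-+ˡ (suc m) = <ᵇ-+ˡ m

  lex-< : ∀ {a b s t q} → a < b → s < q → a * q + s < b * q + t
  lex-< {a} {b} {s} {t} {q} a<b s<q = begin-strict
    a * q + s  <⟨ +-monoʳ-< (a * q) s<q ⟩
    a * q + q  ≡⟨ +-comm (a * q) q ⟩
    suc a * q  ≤⟨ *-monoˡ-≤ q a<b ⟩
    b * q      ≤⟨ m≤m+n (b * q) t ⟩
    b * q + t  ∎
    where open ≤-Reasoning

  <ᵇ-lex : ∀ {a b s t q} → a ≢ b → s < q → t < q → (b * q + t <ᵇ a * q + s) ≡ (b <ᵇ a)
  <ᵇ-lex {a} {b} a≢b s<q t<q with <-cmp a b
  ... | tri< a<b _ _ = trans (<ᵇ-false (<⇒≤ (lex-< a<b s<q))) (sym (<ᵇ-false (<⇒≤ a<b)))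
  ... | tri≈ _ a≡b _ = ⊥-elim (a≢b a≡b)
  ... | tri> _ _ b<a = trans (<ᵇ-true (lex-< b<a t<q)) (sym (<ᵇ-true b<a))

  odd-≢1⇒3≤ : ∀ {n} → n % 2 ≡ 1 → n ≢ 1 → 3 ≤ n
  odd-≢1⇒3≤ {1}                 _ n≢1 = ⊥-elim (n≢1 refl)
  odd-≢1⇒3≤ {suc (suc (suc n))} _ _   = s≤s (s≤s (s≤s z≤n))

module Lists where

  open import Data.Bool using (Bool; true; false; _xor_; _∧_)
  open import Data.List using (List; []; _∷_; _++_; map; length; filterᵇ)
  open import Data.List.Membership.Propositional using (_∈_)
  open import Data.List.Membership.Propositional.Properties using (∈-map⁺; ∈-map⁻; ∈-++⁺ˡ; ∈-++⁺ʳ; ∈-++⁻)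
  open import Data.List.Properties using (map-++; map-∘)
  open import Data.List.Relation.Binary.Permutation.Propositional using (_↭_)
  import Data.List.Relation.Binary.Permutation.Propositional.Properties as ↭
  open import Data.List.Relation.Unary.All using ([]; _∷_)
  open import Data.List.Relation.Unary.Any using (here; there)
  open import Data.List.Relation.Unary.Unique.Propositional using (Unique; []; _∷_)
  open import Data.Nat using (ℕ; suc; _+_; _*_; _≤_; s≤s)
  open import Data.Nat.ListAction using (sum)
  open import Data.Nat.ListAction.Properties using (sum-++; sum-↭)
  open import Data.Nat.Properties using (*-distribˡ-+; *-zeroʳ)
  open import Data.Nat.Tactic.RingSolver using (solve-∀)
  open import Data.Product using (_×_; _,_; ∃₂)
  open import Data.Sum using (inj₁; inj₂)
  open import Function using (_∘_)
  open import Relation.Binary.Definitions using (DecidableEquality)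
  open import Relation.Binary.PropositionalEquality
  open import Relation.Nullary using (yes; no)

  private variable
    X Y : Set

  ∑ : List X → (X → ℕ) → ℕ
  ∑ xs h = sum (map h xs)

  syntax ∑ xs (λ x → e) = ∑[ x ∈ xs ] e

  𝟙 : Bool → ℕ
  𝟙 true  = 1
  𝟙 false = 0

  ∑-cong : ∀ (xs : List X) {h g : X → ℕ} → (∀ {x} → x ∈ xs → h x ≡ g x) → ∑ xs h ≡ ∑ xs g
  ∑-cong []       _ = refl
  ∑-cong (x ∷ xs) e = cong₂ _+_ (e (here refl)) (∑-cong xs (e ∘ there))

  ∑-zero : ∀ (xs : List X) {h : X → ℕ} → (∀ {x} → x ∈ xs → h x ≡ 0) → ∑ xs h ≡ 0
  ∑-zero []       _ = refl
  ∑-zero (x ∷ xs) e = cong₂ _+_ (e (here refl)) (∑-zero xs (e ∘ there))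

  ∑-++ : ∀ (xs ys : List X) (h : X → ℕ) → ∑ (xs ++ ys) h ≡ ∑ xs h + ∑ ys h
  ∑-++ xs ys h = trans (cong sum (map-++ h xs ys)) (sum-++ (map h xs) (map h ys))

  ∑-map : ∀ (f : X → Y) (xs : List X) (h : Y → ℕ) → ∑ (map f xs) h ≡ ∑[ x ∈ xs ] h (f x)
  ∑-map f xs h = cong sum (sym (map-∘ xs))

  ∑-+ : ∀ (xs : List X) (h g : X → ℕ) → ∑[ x ∈ xs ] (h x + g x) ≡ ∑ xs h + ∑ xs g
  ∑-+ []       h g = refl
  ∑-+ (x ∷ xs) h g = trans (cong (h x + g x +_) (∑-+ xs h g)) (interchange (h x) (g x) _ _)
    where
    interchange : ∀ a b c d → a + b + (c + d) ≡ a + c + (b + d)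
    interchange = solve-∀

  ∑-*ˡ : ∀ (xs : List X) (c : ℕ) (h : X → ℕ) → ∑[ x ∈ xs ] (c * h x) ≡ c * ∑ xs h
  ∑-*ˡ []       c h = sym (*-zeroʳ c)
  ∑-*ˡ (x ∷ xs) c h = trans (cong (c * h x +_) (∑-*ˡ xs c h)) (sym (*-distribˡ-+ c (h x) _))

  ∑-const : ∀ (xs : List X) (c : ℕ) → ∑[ _ ∈ xs ] c ≡ length xs * c
  ∑-const []       c = refl
  ∑-const (x ∷ xs) c = cong (c +_) (∑-const xs c)

  ∑-↭ : ∀ {xs ys : List X} (h : X → ℕ) → xs ↭ ys → ∑ xs h ≡ ∑ ys h
  ∑-↭ h p = sum-↭ (↭.map⁺ h p)

  length-filterᵇ : ∀ (p : X → Bool) (xs : List X) → length (filterᵇ p xs) ≡ ∑[ x ∈ xs ] 𝟙 (p x)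
  length-filterᵇ p []       = refl
  length-filterᵇ p (x ∷ xs) with p x
  ... | true  = cong suc (length-filterᵇ p xs)
  ... | false = length-filterᵇ p xs

  𝟙-xor : ∀ x y → 𝟙 (x xor y) + 2 * 𝟙 (x ∧ y) ≡ 𝟙 x + 𝟙 y
  𝟙-xor true  true  = refl
  𝟙-xor true  false = refl
  𝟙-xor false true  = refl
  𝟙-xor false false = refl

  pairs : List X → List (X × X)
  pairs []       = []
  pairs (x ∷ xs) = map (x ,_) xs ++ pairs xs

  ∈-pairs-head : ∀ (x : X) xs {y} → y ∈ xs → (x , y) ∈ pairs (x ∷ xs)
  ∈-pairs-head x xs y∈xs = ∈-++⁺ˡ (∈-map⁺ (x ,_) y∈xs)

  ∈-pairs-tail : ∀ (x : X) xs {p} → p ∈ pairs xs → p ∈ pairs (x ∷ xs)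
  ∈-pairs-tail x xs = ∈-++⁺ʳ (map (x ,_) xs)

  ∈-pairs⁻ : ∀ {a b : X} xs → (a , b) ∈ pairs xs → a ∈ xs × b ∈ xs
  ∈-pairs⁻ (x ∷ xs) p with ∈-++⁻ (map (x ,_) xs) p
  ... | inj₁ p′ with _ , b∈xs , refl ← ∈-map⁻ (x ,_) p′ = here refl , there b∈xs
  ... | inj₂ p′ with a∈xs , b∈xs ← ∈-pairs⁻ xs p′ = there a∈xs , there b∈xs

  two-distinct-avoiding : DecidableEquality X → ∀ {xs : List X} → Unique xs → 3 ≤ length xs →
                          ∀ z → ∃₂ λ (a b : X) → a ≢ b × a ≢ z × b ≢ z
  two-distinct-avoiding _ {[]}             _ ()
  two-distinct-avoiding _ {_ ∷ []}         _ (s≤s ())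
  two-distinct-avoiding _ {_ ∷ _ ∷ []}     _ (s≤s (s≤s ()))
  two-distinct-avoiding _≟_ {x ∷ y ∷ w ∷ _} ((x≢y ∷ x≢w ∷ _) ∷ (y≢w ∷ _) ∷ _) _ z with x ≟ z | y ≟ z
  ... | yes x≡z | _        = y , w , y≢w , x≢y ∘ trans x≡z ∘ sym , x≢w ∘ trans x≡z ∘ sym
  ... | no x≢z   | yes y≡z = x , w , x≢w , x≢z , y≢w ∘ trans y≡z ∘ sym
  ... | no x≢z   | no y≢z   = x , y , x≢y , x≢z , y≢z

  ∑-square : ∀ (xs : List X) (F : X → X → ℕ) → (∀ a b → F a b ≡ F b a) → (∀ a → F a a ≡ 0) →
             ∑[ a ∈ xs ] ∑[ b ∈ xs ] F a b ≡ 2 * ∑[ (a , b) ∈ pairs xs ] F a b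
  ∑-square []       F F-sym F-diag = refl
  ∑-square (x ∷ xs) F F-sym F-diag = begin
    F x x + R + ∑[ a ∈ xs ] (F a x + ∑[ b ∈ xs ] F a b)
      ≡⟨ cong₂ _+_ (cong (_+ R) (F-diag x)) (∑-+ xs (λ a → F a x) _) ⟩
    R + (∑[ a ∈ xs ] F a x + ∑[ a ∈ xs ] ∑[ b ∈ xs ] F a b)
      ≡⟨ cong (R +_) (cong₂ _+_ (∑-cong xs (λ {a} _ → F-sym a x)) (∑-square xs F F-sym F-diag)) ⟩
    R + (R + 2 * P)
      ≡⟨ double R P ⟩
    2 * (R + P)
      ≡⟨ cong (2 *_) (sym (trans (∑-++ (map (x ,_) xs) (pairs xs) _) (cong (_+ P) (∑-map (x ,_) xs _)))) ⟩
    2 * ∑[ (a , b) ∈ pairs (x ∷ xs) ] F a b ∎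
    where
    open ≡-Reasoning
    R = ∑[ b ∈ xs ] F x b
    P = ∑[ (a , b) ∈ pairs xs ] F a b
    double : ∀ r p → r + (r + 2 * p) ≡ 2 * (r + p)
    double = solve-∀

module MinusOnePowers where

  open import Data.Nat using (ℕ; zero; suc; _+_; _*_; _%_)
  open import Data.Nat.Properties using (+-identityʳ)
  open import Data.Sign as Sign using (Sign) renaming (+ to plus; - to minus)
  open import Data.Sign.Properties using (s*s≡+; *-assoc)
  open import Relation.Binary.PropositionalEquality

  infix 8 -1^_

  -1^_ : ℕ → Sign
  -1^ zero  = plus
  -1^ suc n = minus Sign.* -1^ n

  -1^-+ : ∀ m n → -1^ (m + n) ≡ -1^ m Sign.* -1^ n
  -1^-+ zero    n = refl
  -1^-+ (suc m) n = trans (cong (minus Sign.*_) (-1^-+ m n)) (sym (*-assoc minus (-1^ m) (-1^ n)))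

  -1^-2* : ∀ n → -1^ (2 * n) ≡ plus
  -1^-2* n = begin
    -1^ (n + (n + 0))       ≡⟨ cong (λ m → -1^ (n + m)) (+-identityʳ n) ⟩
    -1^ (n + n)             ≡⟨ -1^-+ n n ⟩
    -1^ n Sign.* -1^ n      ≡⟨ s*s≡+ (-1^ n) ⟩
    plus                    ∎
    where open ≡-Reasoning

  -1^-odd* : ∀ m n → m % 2 ≡ 1 → -1^ (m * n) ≡ -1^ n
  -1^-odd* 1             n _   = cong -1^_ (+-identityʳ n)
  -1^-odd* (suc (suc m)) n odd = begin
    -1^ (n + (n + m * n))                    ≡⟨ -1^-+ n (n + m * n) ⟩
    -1^ n Sign.* -1^ (n + m * n)             ≡⟨ cong (-1^ n Sign.*_) (-1^-+ n (m * n)) ⟩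
    -1^ n Sign.* (-1^ n Sign.* -1^ (m * n))  ≡⟨ *-assoc (-1^ n) _ _ ⟨
    -1^ n Sign.* -1^ n Sign.* -1^ (m * n)    ≡⟨ cong₂ Sign._*_ (s*s≡+ (-1^ n)) (-1^-odd* m n odd) ⟩
    -1^ n                                    ∎
    where open ≡-Reasoning

module Enumerations where

  open import Data.List using (List)
  open import Data.List.Membership.Propositional using (_∈_)
  open import Data.List.Relation.Unary.Unique.Propositional using (Unique)
  open import Data.Nat using (ℕ; _<_)
  open import Data.Product using (_,_)
  open import Relation.Binary.PropositionalEquality using (_≡_)
  open Lists using (pairs)

  record RankedEnumeration (A : Set) : Set where
    field
      elements          : List A
      elements-unique   : Unique elements
      elements-complete : ∀ a → a ∈ elements
      rank              : A → ℕ
      rank-injective    : ∀ {a b} → rank a ≡ rank b → a ≡ b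
      rank-increasing   : ∀ {a b} → (a , b) ∈ pairs elements → rank a < rank b

module PermutationSign {A : Set} (R : Enumerations.RankedEnumeration A) where

  open Enumerations.RankedEnumeration R public

  open import Data.Bool using (Bool; true; false; not; _xor_; _∧_)
  open import Data.Bool.Properties using (xor-same; xor-assoc; not-involutive)
  open import Data.Empty using (⊥-elim)
  open import Data.List using ([]; _∷_; _++_; map; length; filterᵇ)
  open import Data.List.Membership.Propositional using (_∈_)
  open import Data.List.Membership.Propositional.Properties using (∈-map⁺; ∈-map⁻; ∈-++⁻)
  open import Data.List.Membership.Propositional.Properties.WithK using (unique∧set⇒bag)
  open import Data.List.Relation.Binary.BagAndSetEquality using (∼bag⇒↭)
  open import Data.List.Relation.Binary.Permutation.Propositional using (_↭_)
  open import Data.List.Relation.Unary.All as All using ()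
  open import Data.List.Relation.Unary.Any using (here; there)
  open import Data.List.Relation.Unary.Any.Properties using (¬Any[]; singleton⁻)
  open import Data.List.Relation.Unary.Unique.Propositional using (Unique; _∷_)
  import Data.List.Relation.Unary.Unique.Propositional.Properties as Unique
  open import Data.Nat using (ℕ; _+_; _*_; _<ᵇ_)
  open import Data.Nat.Properties using (<-cmp; <⇒≤; ≤-refl; *-cancelˡ-≡)
  open import Data.Product using (_×_; _,_; ∃)
  open import Data.Sign as Sign using (Sign) renaming (+ to plus; - to minus)
  import Data.Sign.Properties as Sign
  open import Data.Sum using (inj₁; inj₂)
  open import Function using (_∘_; _↔_; Inverse; Injection; mk↔ₛ′; mk⇔)
  open import Function.Construct.Composition using (_↔-∘_)
  open import Function.Construct.Identity using (↔-id)
  open import Function.Construct.Symmetry using (↔-sym)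
  open import Function.Properties.Inverse using (↔⇒↣)
  open import Relation.Binary.Definitions using (DecidableEquality; tri<; tri≈; tri>)
  open import Relation.Binary.PropositionalEquality hiding ([_])
  open import Relation.Nullary using (Dec; yes; no; map′)

  open Lists
  open MinusOnePowers
  open NatLemmas

  open Inverse using (to; from)

  _≟_ : DecidableEquality A
  a ≟ b = map′ rank-injective (cong rank) (ℕ._≟_ (rank a) (rank b))
    where import Data.Nat as ℕ

  outOfOrder : A → A → Bool
  outOfOrder a b = rank b <ᵇ rank a

  inverted : (A → A) → A × A → Bool
  inverted f (a , b) = outOfOrder (f a) (f b)

  inversions : (A → A) → ℕ
  inversions f = length (filterᵇ (inverted f) (pairs elements))

  sign : A ↔ A → Sign
  sign f = -1^ inversions (to f)

  outOfOrder-irrefl : ∀ a → outOfOrder a a ≡ false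
  outOfOrder-irrefl a = <ᵇ-false (≤-refl {rank a})

  outOfOrder-flip : ∀ {a b} → a ≢ b → outOfOrder b a ≡ not (outOfOrder a b)
  outOfOrder-flip {a} {b} a≢b with <-cmp (rank a) (rank b)
  ... | tri< lt _ _ rewrite <ᵇ-true lt | <ᵇ-false (<⇒≤ lt) = refl
  ... | tri≈ _ eq _ = ⊥-elim (a≢b (rank-injective eq))
  ... | tri> _ _ gt rewrite <ᵇ-true gt | <ᵇ-false (<⇒≤ gt) = refl

  outOfOrder-pairs : ∀ {a b} → (a , b) ∈ pairs elements → outOfOrder a b ≡ false
  outOfOrder-pairs p = <ᵇ-false (<⇒≤ (rank-increasing p))

  reorders : (A → A) → A → A → Bool
  reorders f a b = outOfOrder a b xor outOfOrder (f a) (f b)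

  reorders-sym : ∀ {f} → (∀ {x y} → f x ≡ f y → x ≡ y) → ∀ a b → reorders f a b ≡ reorders f b a
  reorders-sym {f} f-injective a b with a ≟ b
  ... | yes refl = refl
  ... | no a≢b rewrite outOfOrder-flip a≢b | outOfOrder-flip (a≢b ∘ f-injective) =
    sym (not-xor-not (outOfOrder a b) (outOfOrder (f a) (f b)))
    where
    not-xor-not : ∀ x y → not x xor not y ≡ x xor y
    not-xor-not true  y = refl
    not-xor-not false y = not-involutive y

  reorders-diag : ∀ f a → reorders f a a ≡ false
  reorders-diag f a rewrite outOfOrder-irrefl a | outOfOrder-irrefl (f a) = refl

  reorders-∘ : ∀ f g a b → reorders (f ∘ g) a b ≡ reorders g a b xor reorders f (g a) (g b)
  reorders-∘ f g a b = sym (xor-cancel-middle (outOfOrder a b) (outOfOrder (g a) (g b)) _)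
    where
    xor-cancel-middle : ∀ x y z → (x xor y) xor (y xor z) ≡ x xor z
    xor-cancel-middle x y z = begin
      (x xor y) xor (y xor z)  ≡⟨ xor-assoc x y (y xor z) ⟩
      x xor (y xor (y xor z))  ≡⟨ cong (x xor_) (xor-assoc y y z) ⟨
      x xor ((y xor y) xor z)  ≡⟨ cong (λ w → x xor (w xor z)) (xor-same y) ⟩
      x xor z                  ∎
      where open ≡-Reasoning

  inversions≡∑reorders : ∀ f → inversions f ≡ ∑[ (a , b) ∈ pairs elements ] 𝟙 (reorders f a b)
  inversions≡∑reorders f = trans (length-filterᵇ (inverted f) (pairs elements))
    (∑-cong (pairs elements) λ { {a , b} p → cong (λ o → 𝟙 (o xor inverted f (a , b))) (sym (outOfOrder-pairs p)) })

  inversions-cong : ∀ {f g} → (∀ x → f x ≡ g x) → inversions f ≡ inversions g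
  inversions-cong {f} {g} f≗g = begin
    inversions f                                      ≡⟨ length-filterᵇ (inverted f) (pairs elements) ⟩
    ∑[ (a , b) ∈ pairs elements ] 𝟙 (inverted f (a , b))
      ≡⟨ ∑-cong (pairs elements) (λ { {a , b} _ → cong₂ (λ x y → 𝟙 (outOfOrder x y)) (f≗g a) (f≗g b) }) ⟩
    ∑[ (a , b) ∈ pairs elements ] 𝟙 (inverted g (a , b)) ≡⟨ length-filterᵇ (inverted g) (pairs elements) ⟨
    inversions g                                      ∎
    where open ≡-Reasoning

  inversions-id : inversions (λ x → x) ≡ 0
  inversions-id = trans (length-filterᵇ _ (pairs elements))
    (∑-zero (pairs elements) λ { {a , b} p → cong 𝟙 (outOfOrder-pairs p) })

  to-injective : (f : A ↔ A) → ∀ {x y} → to f x ≡ to f y → x ≡ y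
  to-injective f = Injection.injective (↔⇒↣ f)

  map-↭ : (g : A ↔ A) → map (to g) elements ↭ elements
  map-↭ g = ∼bag⇒↭ (unique∧set⇒bag (Unique.map⁺ (to-injective g) elements-unique) elements-unique
    (mk⇔ (λ _ → elements-complete _) (λ _ → image _)))
    where
    image : ∀ y → y ∈ map (to g) elements
    image y = subst (_∈ map (to g) elements) (Inverse.strictlyInverseˡ g y) (∈-map⁺ (to g) (elements-complete (from g y)))

  ∑-reindex : (g : A ↔ A) (h : A → ℕ) → ∑[ a ∈ elements ] h (to g a) ≡ ∑ elements h
  ∑-reindex g h = trans (sym (∑-map (to g) elements h)) (∑-↭ h (map-↭ g))

  ∑-square-reorders : (f : A ↔ A) (g : A → A) →
    ∑[ a ∈ elements ] ∑[ b ∈ elements ] 𝟙 (reorders (to f) (g a) (g b)) ≡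
    2 * ∑[ (a , b) ∈ pairs elements ] 𝟙 (reorders (to f) (g a) (g b))
  ∑-square-reorders f g = ∑-square elements (λ a b → 𝟙 (reorders (to f) (g a) (g b)))
    (λ a b → cong 𝟙 (reorders-sym (to-injective f) (g a) (g b))) (λ a → cong 𝟙 (reorders-diag (to f) (g a)))

  ∑-all-reorders : (f : A ↔ A) → ∑[ a ∈ elements ] ∑[ b ∈ elements ] 𝟙 (reorders (to f) a b) ≡ 2 * inversions (to f)
  ∑-all-reorders f = trans (∑-square-reorders f (λ a → a)) (cong (2 *_) (sym (inversions≡∑reorders (to f))))

  -- The sum over all ordered pairs, unlike the one over increasing pairs, is invariant under reindexing by g.
  ∑-pairs-reorders-reindexed : (f g : A ↔ A) →
    ∑[ (a , b) ∈ pairs elements ] 𝟙 (reorders (to f) (to g a) (to g b)) ≡ inversions (to f)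
  ∑-pairs-reorders-reindexed f g = *-cancelˡ-≡ _ _ 2 (begin
    2 * ∑[ (a , b) ∈ pairs elements ] F (to g a) (to g b)    ≡⟨ ∑-square-reorders f (to g) ⟨
    ∑[ a ∈ elements ] ∑[ b ∈ elements ] F (to g a) (to g b)  ≡⟨ ∑-cong elements (λ {a} _ → ∑-reindex g (F (to g a))) ⟩
    ∑[ a ∈ elements ] ∑[ b ∈ elements ] F (to g a) b         ≡⟨ ∑-reindex g (λ a → ∑[ b ∈ elements ] F a b) ⟩
    ∑[ a ∈ elements ] ∑[ b ∈ elements ] F a b                ≡⟨ ∑-all-reorders f ⟩
    2 * inversions (to f)                                    ∎)
    where
    open ≡-Reasoning
    F : A → A → ℕ
    F a b = 𝟙 (reorders (to f) a b)

  inversions-∘ : (f g : A ↔ A) → ∃ λ c → inversions (to f ∘ to g) + 2 * c ≡ inversions (to g) + inversions (to f)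
  inversions-∘ f g = ∑[ (a , b) ∈ pairs elements ] 𝟙 (Rg a b ∧ Rf a b) , (begin
    inversions (to f ∘ to g) + 2 * ∑[ (a , b) ∈ pairs elements ] 𝟙 (Rg a b ∧ Rf a b)
      ≡⟨ cong₂ _+_ (inversions≡∑reorders (to f ∘ to g)) (sym (∑-*ˡ (pairs elements) 2 _)) ⟩
    ∑[ (a , b) ∈ pairs elements ] 𝟙 (reorders (to f ∘ to g) a b) + ∑[ (a , b) ∈ pairs elements ] (2 * 𝟙 (Rg a b ∧ Rf a b))
      ≡⟨ ∑-+ (pairs elements) _ _ ⟨
    ∑[ (a , b) ∈ pairs elements ] (𝟙 (reorders (to f ∘ to g) a b) + 2 * 𝟙 (Rg a b ∧ Rf a b))
      ≡⟨ ∑-cong (pairs elements) (λ { {a , b} _ →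
           trans (cong (λ x → 𝟙 x + 2 * 𝟙 (Rg a b ∧ Rf a b)) (reorders-∘ (to f) (to g) a b)) (𝟙-xor (Rg a b) (Rf a b)) }) ⟩
    ∑[ (a , b) ∈ pairs elements ] (𝟙 (Rg a b) + 𝟙 (Rf a b))
      ≡⟨ ∑-+ (pairs elements) _ _ ⟩
    ∑[ (a , b) ∈ pairs elements ] 𝟙 (Rg a b) + ∑[ (a , b) ∈ pairs elements ] 𝟙 (Rf a b)
      ≡⟨ cong₂ _+_ (inversions≡∑reorders (to g)) (sym (∑-pairs-reorders-reindexed f g)) ⟨
    inversions (to g) + inversions (to f) ∎)
    where
    open ≡-Reasoning
    Rg Rf : A → A → Bool
    Rg = reorders (to g)
    Rf a b = reorders (to f) (to g a) (to g b)

  sign-∘ : (f g : A ↔ A) → sign (f ↔-∘ g) ≡ sign f Sign.* sign g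
  sign-∘ f g with c , eq ← inversions-∘ f g = begin
    -1^ inversions (to f ∘ to g)                           ≡⟨ Sign.*-identityʳ (-1^ inversions (to f ∘ to g)) ⟨
    -1^ inversions (to f ∘ to g) Sign.* plus               ≡⟨ cong (-1^ inversions (to f ∘ to g) Sign.*_) (-1^-2* c) ⟨
    -1^ inversions (to f ∘ to g) Sign.* -1^ (2 * c)        ≡⟨ -1^-+ (inversions (to f ∘ to g)) (2 * c) ⟨
    -1^ (inversions (to f ∘ to g) + 2 * c)                 ≡⟨ cong -1^_ eq ⟩
    -1^ (inversions (to g) + inversions (to f))            ≡⟨ -1^-+ (inversions (to g)) (inversions (to f)) ⟩
    sign g Sign.* sign f                                   ≡⟨ Sign.*-comm (sign g) (sign f) ⟩
    sign f Sign.* sign g                                   ∎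
    where open ≡-Reasoning

  sign-cong : ∀ {f g : A ↔ A} → (∀ x → to f x ≡ to g x) → sign f ≡ sign g
  sign-cong f≗g = cong -1^_ (inversions-cong f≗g)

  sign-id : sign (↔-id A) ≡ plus
  sign-id = cong -1^_ inversions-id

  sign-conjugate : (g h : A ↔ A) → sign (g ↔-∘ (h ↔-∘ ↔-sym g)) ≡ sign h
  sign-conjugate g h = begin
    sign (g ↔-∘ (h ↔-∘ ↔-sym g))
      ≡⟨ trans (sign-∘ g (h ↔-∘ ↔-sym g)) (cong (sign g Sign.*_) (sign-∘ h (↔-sym g))) ⟩
    sign g Sign.* (sign h Sign.* sign (↔-sym g)) ≡⟨ swap-left (sign g) (sign h) _ ⟩
    sign h Sign.* (sign g Sign.* sign (↔-sym g)) ≡⟨ cong (sign h Sign.*_) (sym (sign-∘ g (↔-sym g))) ⟩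
    sign h Sign.* sign (g ↔-∘ ↔-sym g)
      ≡⟨ cong (sign h Sign.*_) (trans (sign-cong {g ↔-∘ ↔-sym g} {↔-id A} (Inverse.strictlyInverseˡ g)) sign-id) ⟩
    sign h Sign.* plus                           ≡⟨ Sign.*-identityʳ (sign h) ⟩
    sign h                                       ∎
    where
    open ≡-Reasoning
    swap-left : ∀ s t u → s Sign.* (t Sign.* u) ≡ t Sign.* (s Sign.* u)
    swap-left s t u = trans (sym (Sign.*-assoc s t u)) (trans (cong (Sign._* u) (Sign.*-comm s t)) (Sign.*-assoc t s u))

  -- Opaque: unfolding its with-clauses inside composites of transpositions makes conversion checking explode.
  opaque
    transpose : A → A → A → A
    transpose a b x with x ≟ a
    ... | yes _ = b
    ... | no _ with x ≟ b
    ...   | yes _ = a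
    ...   | no _  = x

    transpose-left : ∀ a b → transpose a b a ≡ b
    transpose-left a b with a ≟ a
    ... | yes _  = refl
    ... | no a≢a = ⊥-elim (a≢a refl)

    transpose-right : ∀ a b → transpose a b b ≡ a
    transpose-right a b with b ≟ a
    ... | yes b≡a = b≡a
    ... | no _ with b ≟ b
    ...   | yes _  = refl
    ...   | no b≢b = ⊥-elim (b≢b refl)

    transpose-fixes : ∀ {a b x} → x ≢ a → x ≢ b → transpose a b x ≡ x
    transpose-fixes {a} {b} {x} x≢a x≢b with x ≟ a
    ... | yes x≡a = ⊥-elim (x≢a x≡a)
    ... | no _ with x ≟ b
    ...   | yes x≡b = ⊥-elim (x≢b x≡b)
    ...   | no _    = refl

    transpose-involutive : ∀ a b x → transpose a b (transpose a b x) ≡ x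
    transpose-involutive a b x = by-cases (x ≟ a) (x ≟ b)
      where
      by-cases : Dec (x ≡ a) → Dec (x ≡ b) → transpose a b (transpose a b x) ≡ x
      by-cases (yes refl) _ = trans (cong (transpose x b) (transpose-left x b)) (transpose-right x b)
      by-cases (no _) (yes refl) = trans (cong (transpose a x) (transpose-right a x)) (transpose-left a x)
      by-cases (no x≢a) (no x≢b) = trans (cong (transpose a b) (transpose-fixes x≢a x≢b)) (transpose-fixes x≢a x≢b)

  transposition : A → A → A ↔ A
  transposition a b = mk↔ₛ′ (transpose a b) (transpose a b) (transpose-involutive a b) (transpose-involutive a b)

  transpose-conjugate : (g : A ↔ A) (a b x : A) → to g (transpose a b (from g x)) ≡ transpose (to g a) (to g b) x
  transpose-conjugate g a b x = by-cases (x ≟ to g a) (x ≟ to g b)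
    where
    open ≡-Reasoning
    by-cases : Dec (x ≡ to g a) → Dec (x ≡ to g b) → to g (transpose a b (from g x)) ≡ transpose (to g a) (to g b) x
    by-cases (yes refl) _ = begin
      to g (transpose a b (from g (to g a)))  ≡⟨ cong (λ y → to g (transpose a b y)) (Inverse.strictlyInverseʳ g a) ⟩
      to g (transpose a b a)                  ≡⟨ cong (to g) (transpose-left a b) ⟩
      to g b                                  ≡⟨ transpose-left (to g a) (to g b) ⟨
      transpose (to g a) (to g b) (to g a)    ∎
    by-cases (no _) (yes refl) = begin
      to g (transpose a b (from g (to g b)))  ≡⟨ cong (λ y → to g (transpose a b y)) (Inverse.strictlyInverseʳ g b) ⟩
      to g (transpose a b b)                  ≡⟨ cong (to g) (transpose-right a b) ⟩
      to g a                                  ≡⟨ transpose-right (to g a) (to g b) ⟨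
      transpose (to g a) (to g b) (to g b)    ∎
    by-cases (no x≢ga) (no x≢gb) = begin
      to g (transpose a b (from g x))  ≡⟨ cong (to g) (transpose-fixes (x≢ga ∘ moved a) (x≢gb ∘ moved b)) ⟩
      to g (from g x)                  ≡⟨ Inverse.strictlyInverseˡ g x ⟩
      x                                ≡⟨ transpose-fixes x≢ga x≢gb ⟨
      transpose (to g a) (to g b) x    ∎
      where
      moved : ∀ c → from g x ≡ c → x ≡ to g c
      moved c e = trans (sym (Inverse.strictlyInverseˡ g x)) (cong (to g) e)

  carry : A → A → A → A → A ↔ A
  carry a b c d = transposition (transpose a c b) d ↔-∘ transposition a c

  carry-left : ∀ {a b c d} → a ≢ b → c ≢ d → to (carry a b c d) a ≡ c
  carry-left {a} {b} {c} {d} a≢b c≢d =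
    trans (cong (transpose (transpose a c b) d) (transpose-left a c)) (transpose-fixes c≢b′ c≢d)
    where
    c≢b′ : c ≢ transpose a c b
    c≢b′ c≡b′ = a≢b (trans (sym (transpose-right a c)) (trans (cong (transpose a c) c≡b′) (transpose-involutive a c b)))

  carry-right : ∀ a b c d → to (carry a b c d) b ≡ d
  carry-right a b c d = transpose-left (transpose a c b) d

  sign-transposition-invariant : ∀ {a b c d} → a ≢ b → c ≢ d → sign (transposition c d) ≡ sign (transposition a b)
  sign-transposition-invariant {a} {b} {c} {d} a≢b c≢d = begin
    sign (transposition c d)
      ≡⟨ sign-cong {g ↔-∘ (transposition a b ↔-∘ ↔-sym g)} {transposition c d} conjugate ⟨
    sign (g ↔-∘ (transposition a b ↔-∘ ↔-sym g))
      ≡⟨ sign-conjugate g (transposition a b) ⟩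
    sign (transposition a b) ∎
    where
    open ≡-Reasoning
    g = carry a b c d
    conjugate : ∀ x → to g (transpose a b (from g x)) ≡ transpose c d x
    conjugate x = trans (transpose-conjugate g a b x)
      (cong₂ (λ u v → transpose u v x) (carry-left a≢b c≢d) (carry-right a b c d))

  inversions-first-transposition : ∀ {x y rest} → elements ≡ x ∷ y ∷ rest → inversions (transpose x y) ≡ 1
  inversions-first-transposition {x} {y} {rest} eq = begin
    inversions τ                                                 ≡⟨ cong (λ L → length (filterᵇ (inverted τ) (pairs L))) eq ⟩
    length (filterᵇ (inverted τ) (pairs (x ∷ y ∷ rest)))         ≡⟨ length-filterᵇ (inverted τ) (pairs (x ∷ y ∷ rest)) ⟩
    𝟙 (inverted τ (x , y)) + ∑[ p ∈ tail ] 𝟙 (inverted τ p)     ≡⟨ cong₂ _+_ first-inverted (∑-zero tail tail-in-order) ⟩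
    1                                                            ∎
    where
    open ≡-Reasoning
    τ = transpose x y
    tail = map (x ,_) rest ++ pairs (y ∷ rest)
    in-elements : ∀ {p} → p ∈ pairs (x ∷ y ∷ rest) → p ∈ pairs elements
    in-elements = subst (λ L → _ ∈ pairs L) (sym eq)
    fixes : ∀ {z} → z ∈ rest → τ z ≡ z
    fixes {z} z∈rest with subst Unique eq elements-unique
    ... | x∉ ∷ y∉ ∷ _ = transpose-fixes (All.lookup x∉ (there z∈rest) ∘ sym) (All.lookup y∉ z∈rest ∘ sym)
    first-inverted : 𝟙 (inverted τ (x , y)) ≡ 1
    first-inverted rewrite transpose-left x y | transpose-right x y =
      cong 𝟙 (<ᵇ-true (rank-increasing (in-elements (∈-pairs-head x (y ∷ rest) (here refl)))))
    tail-image : ∀ {a b} → (a , b) ∈ tail → (τ a , τ b) ∈ pairs (x ∷ y ∷ rest)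
    tail-image p with ∈-++⁻ (map (x ,_) rest) p
    ... | inj₁ p′ with z , z∈rest , refl ← ∈-map⁻ (x ,_) p′
      rewrite transpose-left x y | fixes z∈rest = ∈-pairs-tail x (y ∷ rest) (∈-pairs-head y rest z∈rest)
    ... | inj₂ p′ with ∈-++⁻ (map (y ,_) rest) p′
    ...   | inj₁ p″ with z , z∈rest , refl ← ∈-map⁻ (y ,_) p″
      rewrite transpose-right x y | fixes z∈rest = ∈-pairs-head x (y ∷ rest) (there z∈rest)
    tail-image p | inj₂ p′ | inj₂ p″ with a∈rest , b∈rest ← ∈-pairs⁻ rest p″
      rewrite fixes a∈rest | fixes b∈rest = ∈-pairs-tail x (y ∷ rest) (∈-pairs-tail y rest p″)
    tail-in-order : ∀ {p} → p ∈ tail → 𝟙 (inverted τ p) ≡ 0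
    tail-in-order {a , b} p = cong 𝟙 (outOfOrder-pairs (in-elements (tail-image p)))

  sign-transposition : ∀ {a b} → a ≢ b → sign (transposition a b) ≡ minus
  sign-transposition {a} {b} a≢b = by-shape elements refl
    where
    by-shape : ∀ xs → elements ≡ xs → sign (transposition a b) ≡ minus
    by-shape [] eq = ⊥-elim (¬Any[] (subst (a ∈_) eq (elements-complete a)))
    by-shape (x ∷ []) eq =
      ⊥-elim (a≢b (trans (singleton⁻ (subst (a ∈_) eq (elements-complete a)))
                          (sym (singleton⁻ (subst (b ∈_) eq (elements-complete b))))))
    by-shape (x ∷ y ∷ rest) eq with subst Unique eq elements-unique
    ... | x∉ ∷ _ = trans (sign-transposition-invariant (All.lookup x∉ (here refl)) a≢b)
                         (cong -1^_ (inversions-first-transposition eq))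

open import Defs
open import Data.Nat using (ℕ; _+_; _%_)
open import Data.List using (List)
open import Data.Product using (Σ; _×_; _,_)
open import Relation.Binary.PropositionalEquality using (_≡_)

module KrEnumeration {q : ℕ} (k : FiniteField q) where

  open import Data.Empty using (⊥-elim)
  open import Data.List using ([]; _∷_; _++_; map; concatMap; length; allFin)
  open import Data.List.Membership.Propositional using (_∈_)
  open import Data.List.Membership.Propositional.Properties using (∈-map⁺; ∈-map⁻; ∈-++⁺ˡ; ∈-++⁺ʳ; ∈-++⁻; ∈-allFin)
  open import Data.List.Properties using (length-map; length-++; length-tabulate)
  open import Data.List.Relation.Unary.All as All using ()
  open import Data.List.Relation.Unary.Any using (here; there)
  open import Data.List.Relation.Unary.Unique.Propositional using (Unique; []; _∷_)
  import Data.List.Relation.Unary.Unique.Propositional.Properties as Unique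
  open import Data.Nat using (zero; suc; _*_; _<_; z≤n; s≤s)
  open import Data.Nat.Properties using (suc-injective; 0≢1+n; +-assoc; *-identityʳ)
  open import Data.Nat.Tactic.RingSolver using (solve-∀)
  open import Data.Sum using (inj₁; inj₂)
  open import Data.Vec using ([]; _∷_; _∷ʳ_; init)
  import Data.Vec.Properties as Vec
  open import Function using (_∘_; Inverse; Injection)
  open import Function.Construct.Symmetry using (↔-sym)
  open import Function.Properties.Inverse using (↔⇒↣)
  open import Relation.Binary.Definitions using (DecidableEquality)
  open import Relation.Binary.PropositionalEquality hiding ([_])
  open import Relation.Nullary using (¬_; Dec; yes; no)

  open FiniteField k using (Carrier; card)
  open Lists

  private variable
    r : ℕ

  _≟ᵥ_ : DecidableEquality (Kr k r)
  _≟ᵥ_ = Vec.≡-dec (_≟k_ k)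

  index-here : ∀ (v : Kr k r) vs → index k (v ∷ vs) v ≡ 0
  index-here v vs with v ≟ᵥ v
  ... | yes _  = refl
  ... | no v≢v = ⊥-elim (v≢v refl)

  index-there : ∀ {u v : Kr k r} vs → u ≢ v → index k (u ∷ vs) v ≡ suc (index k vs v)
  index-there {u = u} {v} vs u≢v with u ≟ᵥ v
  ... | yes u≡v = ⊥-elim (u≢v u≡v)
  ... | no _    = refl

  index-injective : ∀ (vs : List (Kr k r)) {a b} → a ∈ vs → b ∈ vs → index k vs a ≡ index k vs b → a ≡ b
  index-injective (v ∷ vs) {a} {b} a∈ b∈ eq with v ≟ᵥ a | v ≟ᵥ b
  ... | yes v≡a | yes v≡b = trans (sym v≡a) v≡b
  ... | yes _   | no _    = ⊥-elim (0≢1+n eq)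
  ... | no _    | yes _   = ⊥-elim (0≢1+n (sym eq))
  ... | no v≢a  | no v≢b with a∈ | b∈
  ...   | here refl | _         = ⊥-elim (v≢a refl)
  ...   | there _   | here refl = ⊥-elim (v≢b refl)
  ...   | there a∈′ | there b∈′ = index-injective vs a∈′ b∈′ (suc-injective eq)

  index-increasing : ∀ {vs : List (Kr k r)} → Unique vs → ∀ {a b} → (a , b) ∈ pairs vs → index k vs a < index k vs b
  index-increasing {vs = v ∷ vs} (v∉ ∷ vs-unique) p with ∈-++⁻ (map (v ,_) vs) p
  ... | inj₁ p′ with b , b∈vs , refl ← ∈-map⁻ (v ,_) p′
    rewrite index-here v vs | index-there vs (All.lookup v∉ b∈vs) = s≤s z≤n
  ... | inj₂ p′ with a∈vs , b∈vs ← ∈-pairs⁻ vs p′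
    rewrite index-there vs (All.lookup v∉ a∈vs) | index-there vs (All.lookup v∉ b∈vs) = s≤s (index-increasing vs-unique p′)

  index-< : ∀ {vs : List (Kr k r)} {v} → v ∈ vs → index k vs v < length vs
  index-< {vs = u ∷ vs} {v} v∈ with u ≟ᵥ v
  ... | yes _ = s≤s z≤n
  ... | no u≢v with v∈
  ...   | here refl = ⊥-elim (u≢v refl)
  ...   | there v∈′ = s≤s (index-< v∈′)

  prefixAll : List Carrier → List (Kr k r) → List (Kr k (suc r))
  prefixAll xs vs = concatMap (λ x → map (x ∷_) vs) xs

  ∈-prefixAll : ∀ {xs} {vs : List (Kr k r)} {x v} → x ∈ xs → v ∈ vs → (x ∷ v) ∈ prefixAll xs vs
  ∈-prefixAll {vs = vs} (here refl) v∈vs = ∈-++⁺ˡ (∈-map⁺ (_ ∷_) v∈vs)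
  ∈-prefixAll {vs = vs} (there {x = y} x∈xs) v∈vs = ∈-++⁺ʳ (map (y ∷_) vs) (∈-prefixAll x∈xs v∈vs)

  head-∈-prefixAll : ∀ xs (vs : List (Kr k r)) {x v} → (x ∷ v) ∈ prefixAll xs vs → x ∈ xs
  head-∈-prefixAll (y ∷ xs) vs w∈ with ∈-++⁻ (map (y ∷_) vs) w∈
  ... | inj₁ w∈′ with _ , _ , refl ← ∈-map⁻ (y ∷_) w∈′ = here refl
  ... | inj₂ w∈′ = there (head-∈-prefixAll xs vs w∈′)

  prefixAll-unique : ∀ {xs} {vs : List (Kr k r)} → Unique xs → Unique vs → Unique (prefixAll xs vs)
  prefixAll-unique {xs = []}     _               _         = []
  prefixAll-unique {xs = x ∷ xs} {vs} (x∉ ∷ xs-unique) vs-unique =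
    Unique.++⁺ (Unique.map⁺ Vec.∷-injectiveʳ vs-unique) (prefixAll-unique xs-unique vs-unique) disjoint
    where
    disjoint : ∀ {w} → ¬ (w ∈ map (x ∷_) vs × w ∈ prefixAll xs vs)
    disjoint (w∈₁ , w∈₂) with _ , _ , refl ← ∈-map⁻ (x ∷_) w∈₁ = All.lookup x∉ (head-∈-prefixAll xs vs w∈₂) refl

  length-prefixAll : ∀ xs (vs : List (Kr k r)) → length (prefixAll xs vs) ≡ length xs * length vs
  length-prefixAll []       vs = refl
  length-prefixAll (x ∷ xs) vs =
    trans (length-++ (map (x ∷_) vs)) (cong₂ _+_ (length-map (x ∷_) vs) (length-prefixAll xs vs))

  ∑-prefixAll : ∀ xs (vs : List (Kr k r)) (F : Kr k (suc r) → ℕ) →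
                ∑ (prefixAll xs vs) F ≡ ∑[ x ∈ xs ] ∑[ v ∈ vs ] F (x ∷ v)
  ∑-prefixAll []       vs F = refl
  ∑-prefixAll (x ∷ xs) vs F =
    trans (∑-++ (map (x ∷_) vs) (prefixAll xs vs) F) (cong₂ _+_ (∑-map (x ∷_) vs F) (∑-prefixAll xs vs F))

  index-map-∷ : ∀ x {vs : List (Kr k r)} ws {v} → v ∈ vs → index k (map (x ∷_) vs ++ ws) (x ∷ v) ≡ index k vs v
  index-map-∷ x {u ∷ vs} ws {v} = by-cases (u ≟ᵥ v)
    where
    by-cases : Dec (u ≡ v) → v ∈ u ∷ vs → index k (map (x ∷_) (u ∷ vs) ++ ws) (x ∷ v) ≡ index k (u ∷ vs) v
    by-cases (yes refl) _            = trans (index-here (x ∷ u) _) (sym (index-here u vs))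
    by-cases (no u≢v)   (here refl)  = ⊥-elim (u≢v refl)
    by-cases (no u≢v)   (there v∈′) =
      trans (index-there _ (u≢v ∘ Vec.∷-injectiveʳ)) (trans (cong suc (index-map-∷ x ws v∈′)) (sym (index-there vs u≢v)))

  index-map-∷-other : ∀ {x y} (vs : List (Kr k r)) ws v → y ≢ x →
                      index k (map (y ∷_) vs ++ ws) (x ∷ v) ≡ length vs + index k ws (x ∷ v)
  index-map-∷-other []       ws v y≢x = refl
  index-map-∷-other (u ∷ vs) ws v y≢x =
    trans (index-there _ (y≢x ∘ Vec.∷-injectiveˡ)) (cong suc (index-map-∷-other vs ws v y≢x))

  index-prefixAll : ∀ xs (vs : List (Kr k r)) {x v} → x ∈ xs → v ∈ vs →
    index k (prefixAll xs vs) (x ∷ v) ≡ index k (prefixAll xs ([] ∷ [])) (x ∷ []) * length vs + index k vs v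
  index-prefixAll (y ∷ xs) vs {x} {v} x∈ v∈ = by-cases (_≟k_ k y x) x∈
    where
    open ≡-Reasoning
    by-cases : Dec (y ≡ x) → x ∈ y ∷ xs →
      index k (prefixAll (y ∷ xs) vs) (x ∷ v) ≡ index k (prefixAll (y ∷ xs) ([] ∷ [])) (x ∷ []) * length vs + index k vs v
    by-cases (yes refl) _ = begin
      index k (map (y ∷_) vs ++ prefixAll xs vs) (y ∷ v)
        ≡⟨ index-map-∷ y (prefixAll xs vs) v∈ ⟩
      index k vs v
        ≡⟨ cong (λ n → n * length vs + index k vs v) (index-here (y ∷ []) _) ⟨
      index k (prefixAll (y ∷ xs) ([] ∷ [])) (y ∷ []) * length vs + index k vs v ∎
    by-cases (no y≢x) (here refl) = ⊥-elim (y≢x refl)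
    by-cases (no y≢x) (there x∈′) = begin
      index k (map (y ∷_) vs ++ prefixAll xs vs) (x ∷ v)
        ≡⟨ index-map-∷-other vs _ v y≢x ⟩
      length vs + index k (prefixAll xs vs) (x ∷ v)
        ≡⟨ cong (length vs +_) (index-prefixAll xs vs x∈′ v∈) ⟩
      length vs + (index k (prefixAll xs ([] ∷ [])) (x ∷ []) * length vs + index k vs v)
        ≡⟨ +-assoc (length vs) _ _ ⟨
      suc (index k (prefixAll xs ([] ∷ [])) (x ∷ [])) * length vs + index k vs v
        ≡⟨ cong (λ n → n * length vs + index k vs v) (index-map-∷-other ([] ∷ []) _ [] y≢x) ⟨
      index k (prefixAll (y ∷ xs) ([] ∷ [])) (x ∷ []) * length vs + index k vs v ∎

  allK-unique : Unique (allK k)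
  allK-unique = Unique.map⁺ (Injection.injective (↔⇒↣ (↔-sym card))) (Unique.allFin⁺ q)

  allK-complete : ∀ x → x ∈ allK k
  allK-complete x = subst (_∈ allK k) (Inverse.strictlyInverseʳ card x) (∈-map⁺ (Inverse.from card) (∈-allFin (Inverse.to card x)))

  length-allK : length (allK k) ≡ q
  length-allK = trans (length-map _ (allFin q)) (length-tabulate (λ i → i))

  allVecs-unique : ∀ r → Unique (allVecs k r)
  allVecs-unique zero    = All.[] ∷ []
  allVecs-unique (suc r) = prefixAll-unique allK-unique (allVecs-unique r)

  allVecs-complete : ∀ r (v : Kr k r) → v ∈ allVecs k r
  allVecs-complete zero    []      = here refl
  allVecs-complete (suc r) (x ∷ v) = ∈-prefixAll (allK-complete x) (allVecs-complete r v)

  length-allVecs-suc : ∀ r → length (allVecs k (suc r)) ≡ q * length (allVecs k r)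
  length-allVecs-suc r = trans (length-prefixAll (allK k) (allVecs k r)) (cong (_* length (allVecs k r)) length-allK)

  enumeration : ∀ r → Enumerations.RankedEnumeration (Kr k r)
  enumeration r = record
    { elements          = allVecs k r
    ; elements-unique   = allVecs-unique r
    ; elements-complete = allVecs-complete r
    ; rank              = index k (allVecs k r)
    ; rank-injective    = λ {a} {b} → index-injective (allVecs k r) (allVecs-complete r a) (allVecs-complete r b)
    ; rank-increasing   = index-increasing (allVecs-unique r)
    }

  digit : Carrier → ℕ
  digit s = index k (allVecs k 1) (s ∷ [])

  digit-< : ∀ s → digit s < q
  digit-< s = subst (digit s <_) (trans (length-prefixAll (allK k) ([] ∷ [])) (trans (*-identityʳ _) length-allK))
                    (index-< (allVecs-complete 1 (s ∷ [])))

  index-∷ : ∀ r x (v : Kr k r) → index k (allVecs k (suc r)) (x ∷ v) ≡ digit x * length (allVecs k r) + index k (allVecs k r) v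
  index-∷ r x v = index-prefixAll (allK k) (allVecs k r) (allK-complete x) (allVecs-complete r v)

  index-∷ʳ : ∀ r (u : Kr k r) s → index k (allVecs k (suc r)) (u ∷ʳ s) ≡ index k (allVecs k r) u * q + digit s
  index-∷ʳ zero    []      s = refl
  index-∷ʳ (suc r) (x ∷ u) s = begin
    index k (allVecs k (suc (suc r))) (x ∷ (u ∷ʳ s))                    ≡⟨ index-∷ (suc r) x (u ∷ʳ s) ⟩
    digit x * length (allVecs k (suc r)) + index k (allVecs k (suc r)) (u ∷ʳ s)
      ≡⟨ cong₂ (λ n m → digit x * n + m) (length-allVecs-suc r) (index-∷ʳ r u s) ⟩
    digit x * (q * length (allVecs k r)) + (index k (allVecs k r) u * q + digit s)
      ≡⟨ regroup (digit x) q (length (allVecs k r)) (index k (allVecs k r) u) (digit s) ⟩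
    (digit x * length (allVecs k r) + index k (allVecs k r) u) * q + digit s
      ≡⟨ cong (λ n → n * q + digit s) (index-∷ r x u) ⟨
    index k (allVecs k (suc r)) (x ∷ u) * q + digit s                   ∎
    where
    open ≡-Reasoning
    regroup : ∀ a b c d e → a * (b * c) + (d * b + e) ≡ (a * c + d) * b + e
    regroup = solve-∀

  ∑-allVecs-init : ∀ r (G : Kr k r → ℕ) → ∑[ w ∈ allVecs k (suc r) ] G (init w) ≡ q * ∑ (allVecs k r) G
  ∑-allVecs-init zero    G =
    trans (∑-prefixAll (allK k) ([] ∷ []) _) (trans (∑-const (allK k) (G [] + 0)) (cong (_* (G [] + 0)) length-allK))
  ∑-allVecs-init (suc r) G = begin
    ∑[ w ∈ allVecs k (suc (suc r)) ] G (init w)                ≡⟨ ∑-prefixAll (allK k) (allVecs k (suc r)) _ ⟩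
    ∑[ x ∈ allK k ] ∑[ w ∈ allVecs k (suc r) ] G (x ∷ init w)  ≡⟨ ∑-cong (allK k) (λ {x} _ → ∑-allVecs-init r (G ∘ (x ∷_))) ⟩
    ∑[ x ∈ allK k ] (q * ∑[ u ∈ allVecs k r ] G (x ∷ u))       ≡⟨ ∑-*ˡ (allK k) q _ ⟩
    q * ∑[ x ∈ allK k ] ∑[ u ∈ allVecs k r ] G (x ∷ u)         ≡⟨ cong (q *_) (∑-prefixAll (allK k) (allVecs k r) G) ⟨
    q * ∑ (allVecs k (suc r)) G                                ∎
    where open ≡-Reasoning

module Σ*Sign {q : ℕ} (k : FiniteField q) where

  open import Data.Bool using (false; _xor_)
  open import Data.Bool.Properties using (xor-same)
  open import Data.Fin as Fin using (Fin)
  open import Data.List using ([]; _∷_; _++_; map; length; filterᵇ)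
  open import Data.Nat using (zero; suc; _*_; _≤_; _<ᵇ_)
  open import Data.Nat.Properties using (*-cancelˡ-≡)
  open import Data.Nat.Tactic.RingSolver using (solve-∀)
  open import Data.Product using (proj₂)
  open import Data.Sign as Sign using () renaming (- to minus)
  open import Data.Sign.Properties using (opposite-involutive)
  open import Data.Vec using ([]; _∷_; init; initLast; last)
  import Data.Vec.Properties as Vec
  open import Function using (_∘_; Injection)
  open import Function.Properties.Inverse using (↔⇒↣)
  open import Relation.Binary.PropositionalEquality hiding ([_])
  open import Relation.Nullary using (Dec; yes; no)

  open KrEnumeration k
  open Lists
  open MinusOnePowers
  open NatLemmas
  module Perm r = PermutationSign (enumeration r)

  parity≡-1^ : ∀ n → parity k n ≡ -1^ n
  parity≡-1^ zero          = refl
  parity≡-1^ (suc zero)    = refl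
  parity≡-1^ (suc (suc n)) = trans (parity≡-1^ n) (sym (opposite-involutive (-1^ n)))

  orderedPairs≡pairs : ∀ {A : Set} (xs : List A) → orderedPairs k xs ≡ pairs xs
  orderedPairs≡pairs []       = refl
  orderedPairs≡pairs (x ∷ xs) = cong (map (x ,_) xs ++_) (orderedPairs≡pairs xs)

  sgn≡sign : ∀ {r} (σ : Σ* k r) → sgn k σ ≡ Perm.sign r (perm σ)
  sgn≡sign {r} σ = trans (parity≡-1^ (inversions k σ))
    (cong (λ ps → -1^ length (filterᵇ (Perm.inverted r (app k σ)) ps)) (orderedPairs≡pairs (allVecs k r)))

  sgn-∘ : ∀ {r} (σ τ : Σ* k r) → sgn k (_∘*_ k σ τ) ≡ sgn k σ Sign.* sgn k τ
  sgn-∘ {r} σ τ = trans (sgn≡sign (_∘*_ k σ τ))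
    (trans (Perm.sign-∘ r (perm σ) (perm τ)) (sym (cong₂ Sign._*_ (sgn≡sign σ) (sgn≡sign τ))))

  sgn-≈ : ∀ {r} {σ τ : Σ* k r} → _≈*_ k σ τ → sgn k σ ≡ sgn k τ
  sgn-≈ {r} {σ} {τ} σ≈τ = trans (sgn≡sign σ) (trans (Perm.sign-cong r {perm σ} {perm τ} σ≈τ) (sym (sgn≡sign τ)))

  rank-split : ∀ r (w : Kr k (suc r)) → index k (allVecs k (suc r)) w ≡ index k (allVecs k r) (init w) * q + digit (last w)
  rank-split r w = trans (cong (index k (allVecs k (suc r))) (proj₂ (proj₂ (initLast w)))) (index-∷ʳ r (init w) (last w))

  outOfOrder-lex : ∀ r {u u′ : Kr k r} s t → u ≢ u′ →
    (index k (allVecs k r) u′ * q + digit t <ᵇ index k (allVecs k r) u * q + digit s) ≡ Perm.outOfOrder r u u′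
  outOfOrder-lex r s t u≢u′ = <ᵇ-lex (u≢u′ ∘ Perm.rank-injective r) (digit-< s) (digit-< t)

  reorders-i : ∀ r (σ : Σ* k r) w w′ →
    Perm.reorders (suc r) (app k (i k r σ)) w w′ ≡ Perm.reorders r (app k σ) (init w) (init w′)
  reorders-i r σ w w′ = by-cases (init w ≟ᵥ init w′)
    where
    open ≡-Reasoning
    rk = index k (allVecs k r)
    u = init w
    u′ = init w′
    s = last w
    t = last w′
    σ↾ = app k σ
    before : Perm.outOfOrder (suc r) w w′ ≡ (rk u′ * q + digit t <ᵇ rk u * q + digit s)
    before = cong₂ _<ᵇ_ (rank-split r w′) (rank-split r w)
    after : Perm.outOfOrder (suc r) (app k (i k r σ) w) (app k (i k r σ) w′) ≡ (rk (σ↾ u′) * q + digit t <ᵇ rk (σ↾ u) * q + digit s)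
    after = cong₂ _<ᵇ_ (index-∷ʳ r (σ↾ u′) t) (index-∷ʳ r (σ↾ u) s)
    by-cases : Dec (u ≡ u′) → Perm.reorders (suc r) (app k (i k r σ)) w w′ ≡ Perm.reorders r σ↾ u u′
    by-cases (yes u≡u′) = begin
      Perm.reorders (suc r) (app k (i k r σ)) w w′
        ≡⟨ cong₂ _xor_ (trans before (same-leading-digit rk)) (trans after (same-leading-digit (rk ∘ σ↾))) ⟩
      (digit t <ᵇ digit s) xor (digit t <ᵇ digit s)   ≡⟨ xor-same (digit t <ᵇ digit s) ⟩
      false                                           ≡⟨ Perm.reorders-diag r σ↾ u ⟨
      Perm.reorders r σ↾ u u                         ≡⟨ cong (Perm.reorders r σ↾ u) u≡u′ ⟩
      Perm.reorders r σ↾ u u′                        ∎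
      where
      same-leading-digit : (f : Kr k r → ℕ) → (f u′ * q + digit t <ᵇ f u * q + digit s) ≡ (digit t <ᵇ digit s)
      same-leading-digit f = trans (cong (λ v → f v * q + digit t <ᵇ f u * q + digit s) (sym u≡u′)) (<ᵇ-+ˡ (f u * q))
    by-cases (no u≢u′) = cong₂ _xor_ (trans before (outOfOrder-lex r s t u≢u′))
                                     (trans after (outOfOrder-lex r s t (u≢u′ ∘ Perm.to-injective r (perm σ))))

  inversions-i : ∀ r (σ : Σ* k r) → Perm.inversions (suc r) (app k (i k r σ)) ≡ q * (q * Perm.inversions r (app k σ))
  inversions-i r σ = *-cancelˡ-≡ _ _ 2 (begin
    2 * Perm.inversions (suc r) (app k (i k r σ))
      ≡⟨ Perm.∑-all-reorders (suc r) (perm (i k r σ)) ⟨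
    ∑[ w ∈ allVecs k (suc r) ] ∑[ w′ ∈ allVecs k (suc r) ] 𝟙 (Perm.reorders (suc r) (app k (i k r σ)) w w′)
      ≡⟨ ∑-cong (allVecs k (suc r)) (λ {w} _ → ∑-cong (allVecs k (suc r)) (λ {w′} _ → cong 𝟙 (reorders-i r σ w w′))) ⟩
    ∑[ w ∈ allVecs k (suc r) ] ∑[ w′ ∈ allVecs k (suc r) ] 𝟙 (Perm.reorders r (app k σ) (init w) (init w′))
      ≡⟨ ∑-cong (allVecs k (suc r)) (λ {w} _ → ∑-allVecs-init r (λ u′ → 𝟙 (Perm.reorders r (app k σ) (init w) u′))) ⟩
    ∑[ w ∈ allVecs k (suc r) ] (q * ∑[ u′ ∈ allVecs k r ] 𝟙 (Perm.reorders r (app k σ) (init w) u′))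
      ≡⟨ ∑-*ˡ (allVecs k (suc r)) q _ ⟩
    q * ∑[ w ∈ allVecs k (suc r) ] ∑[ u′ ∈ allVecs k r ] 𝟙 (Perm.reorders r (app k σ) (init w) u′)
      ≡⟨ cong (q *_) (∑-allVecs-init r (λ u → ∑[ u′ ∈ allVecs k r ] 𝟙 (Perm.reorders r (app k σ) u u′))) ⟩
    q * (q * ∑[ u ∈ allVecs k r ] ∑[ u′ ∈ allVecs k r ] 𝟙 (Perm.reorders r (app k σ) u u′))
      ≡⟨ cong (λ n → q * (q * n)) (Perm.∑-all-reorders r (perm σ)) ⟩
    q * (q * (2 * Perm.inversions r (app k σ)))
      ≡⟨ regroup q (Perm.inversions r (app k σ)) ⟩
    2 * (q * (q * Perm.inversions r (app k σ))) ∎)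
    where
    open ≡-Reasoning
    regroup : ∀ a b → a * (a * (2 * b)) ≡ 2 * (a * (a * b))
    regroup = solve-∀

  sgn-i : q % 2 ≡ 1 → ∀ r (σ : Σ* k r) → sgn k (i k r σ) ≡ sgn k σ
  sgn-i q-odd r σ = begin
    sgn k (i k r σ)                                  ≡⟨ sgn≡sign (i k r σ) ⟩
    -1^ Perm.inversions (suc r) (app k (i k r σ))   ≡⟨ cong -1^_ (inversions-i r σ) ⟩
    -1^ (q * (q * Perm.inversions r (app k σ)))     ≡⟨ -1^-odd* q _ q-odd ⟩
    -1^ (q * Perm.inversions r (app k σ))           ≡⟨ -1^-odd* q _ q-odd ⟩
    -1^ Perm.inversions r (app k σ)                 ≡⟨ sgn≡sign σ ⟨
    sgn k σ                                          ∎
    where open ≡-Reasoning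

  transposition* : ∀ {r} (a b : Kr k r) → a ≢ zeroV k r → b ≢ zeroV k r → Σ* k r
  transposition* {r} a b a≢0 b≢0 = record
    { perm = Perm.transposition r a b
    ; fix0 = Perm.transpose-fixes r (a≢0 ∘ sym) (b≢0 ∘ sym)
    }

  sgn-transposition* : ∀ {r} {a b : Kr k r} a≢0 b≢0 → a ≢ b → sgn k (transposition* a b a≢0 b≢0) ≡ minus
  sgn-transposition* {r} a≢0 b≢0 a≢b = trans (sgn≡sign (transposition* _ _ a≢0 b≢0)) (Perm.sign-transposition r a≢b)

  q≢1 : q ≢ 1
  q≢1 q≡1 = 0≢1 (subst (0# ≈_) (Injection.injective (↔⇒↣ card) (Fin-1-trivial q≡1 _ _)) ≈-refl)
    where
    open FiniteField k using (_≈_; 0#; 0≢1; card) renaming (refl to ≈-refl)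
    Fin-1-trivial : ∀ {n} → n ≡ 1 → (i j : Fin n) → i ≡ j
    Fin-1-trivial refl Fin.zero Fin.zero = refl

  sgn-surjective : q % 2 ≡ 1 → Σ ℕ λ r → Σ (Σ* k r) λ σ → sgn k σ ≡ minus
  sgn-surjective q-odd
    with a , b , a≢b , a≢0 , b≢0 ← two-distinct-avoiding (_≟k_ k) allK-unique
                                     (subst (3 ≤_) (sym length-allK) (odd-≢1⇒3≤ q-odd q≢1)) (FiniteField.0# k) =
    1 , transposition* (a ∷ []) (b ∷ []) a∷≢0 b∷≢0 , sgn-transposition* a∷≢0 b∷≢0 (a≢b ∘ Vec.∷-injectiveˡ)
    where
    a∷≢0 = a≢0 ∘ Vec.∷-injectiveˡ
    b∷≢0 = b≢0 ∘ Vec.∷-injectiveˡ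

module KernelOfSgn {q : ℕ} (k : FiniteField q) where

  open import Data.Empty using (⊥-elim)
  open import Data.List using ([]; _∷_; length)
  open import Data.List.Membership.Propositional using (_∉_)
  open import Data.List.Relation.Unary.Any using (here; there)
  open import Data.Product using (proj₁; proj₂)
  open import Data.Sign as Sign using () renaming (+ to plus)
  open import Data.Sign.Properties using (opposite-involutive)
  open import Function using (_∘_)
  open import Relation.Binary.PropositionalEquality hiding ([_])
  open import Relation.Nullary using (Dec; yes; no)

  open KrEnumeration k
  open MinusOnePowers
  open Σ*Sign k

  record NonzeroTransposition (r : ℕ) : Set where
    field
      {a b} : Kr k r
      a≢b   : a ≢ b
      a≢0   : a ≢ zeroV k r
      b≢0   : b ≢ zeroV k r

    toΣ* : Σ* k r
    toΣ* = transposition* a b a≢0 b≢0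

  open NonzeroTransposition using (toΣ*)

  product : ∀ {r} → List (NonzeroTransposition r) → Σ* k r
  product []       = id* k
  product (t ∷ ts) = _∘*_ k (toΣ* t) (product ts)

  sgn-product : ∀ {r} (ts : List (NonzeroTransposition r)) → sgn k (product ts) ≡ -1^ length ts
  sgn-product {r} []       = trans (sgn≡sign (id* k {r})) (Perm.sign-id r)
  sgn-product {r} (t ∷ ts) = trans (sgn-∘ (toΣ* t) (product ts))
    (cong₂ Sign._*_ (sgn-transposition* a≢0 b≢0 a≢b) (sgn-product ts))
    where open NonzeroTransposition t hiding (toΣ*)

  decompose : ∀ {r} (L : List (Kr k r)) (σ : Σ* k r) → (∀ x → x ∉ L → app k σ x ≡ x) →
              Σ (List (NonzeroTransposition r)) λ ts → _≈*_ k σ (product ts)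
  decompose []      σ fixed = [] , λ x → fixed x λ ()
  decompose {r} (a ∷ L) σ fixed = by-cases (app k σ a ≟ᵥ a)
    where
    fixed-off-L : app k σ a ≡ a → ∀ x → x ∉ L → app k σ x ≡ x
    fixed-off-L σa≡a x x∉L with x ≟ᵥ a
    ... | yes refl = σa≡a
    ... | no x≢a   = fixed x λ { (here x≡a) → x≢a x≡a ; (there x∈L) → x∉L x∈L }
    by-cases : Dec (app k σ a ≡ a) → Σ (List (NonzeroTransposition r)) λ ts → _≈*_ k σ (product ts)
    by-cases (yes σa≡a) = decompose L σ (fixed-off-L σa≡a)
    by-cases (no σa≢a)  = t ∷ ts , λ x → trans (sym (Perm.transpose-involutive r a (app k σ a) (app k σ x))) (cong τ (σ′≈ x))
      where
      a≢0 : a ≢ zeroV k r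
      a≢0 refl = σa≢a (fix0 σ)
      σa≢0 : app k σ a ≢ zeroV k r
      σa≢0 σa≡0 = a≢0 (Perm.to-injective r (perm σ) (trans σa≡0 (sym (fix0 σ))))
      t : NonzeroTransposition r
      t = record { a≢b = σa≢a ∘ sym ; a≢0 = a≢0 ; b≢0 = σa≢0 }
      τ = Perm.transpose r a (app k σ a)
      σ′ = _∘*_ k (toΣ* t) σ
      σ′-fixed : ∀ x → x ∉ L → app k σ′ x ≡ x
      σ′-fixed x x∉L with x ≟ᵥ a
      ... | yes refl = Perm.transpose-right r x (app k σ x)
      ... | no x≢a   = trans (cong τ σx≡x) (Perm.transpose-fixes r x≢a (x≢a ∘ Perm.to-injective r (perm σ) ∘ trans σx≡x))
        where
        σx≡x : app k σ x ≡ x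
        σx≡x = fixed x λ { (here x≡a) → x≢a x≡a ; (there x∈L) → x∉L x∈L }
      IH = decompose L σ′ σ′-fixed
      ts = proj₁ IH
      σ′≈ = proj₂ IH

  -- Perm.carry a b c d as an element of Σ*, where s = (a b) and t = (c d).
  conjugator : ∀ {r} → NonzeroTransposition r → NonzeroTransposition r → Σ* k r
  conjugator {r} s t = _∘*_ k (transposition* b′ d b′≢0 d≢0) (transposition* a c a≢0 c≢0)
    where
    open NonzeroTransposition s hiding (toΣ*)
    open NonzeroTransposition t hiding (toΣ*) renaming (a to c; b to d; a≢0 to c≢0; b≢0 to d≢0)
    b′ = Perm.transpose r a c b
    b′≢0 : b′ ≢ zeroV k r
    b′≢0 b′≡0 = b≢0 (Perm.to-injective r (Perm.transposition r a c)
                      (trans b′≡0 (sym (Perm.transpose-fixes r (a≢0 ∘ sym) (c≢0 ∘ sym)))))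

  commutator-conjugator : ∀ {r} (s t : NonzeroTransposition r) →
    _≈*_ k (comm* k (toΣ* s) (conjugator s t)) (_∘*_ k (toΣ* s) (toΣ* t))
  commutator-conjugator {r} s t x = cong (Perm.transpose r a b)
    (trans (Perm.transpose-conjugate r (perm (conjugator s t)) a b x)
           (cong₂ (λ u v → Perm.transpose r u v x) (Perm.carry-left r a≢b c≢d) (Perm.carry-right r a b c d)))
    where
    open NonzeroTransposition s hiding (toΣ*)
    open NonzeroTransposition t hiding (toΣ*) renaming (a to c; b to d; a≢b to c≢d)

  even-product-of-commutators : ∀ {r} (ts : List (NonzeroTransposition r)) → -1^ length ts ≡ plus →
    Σ (List (Σ* k r × Σ* k r)) λ cs → _≈*_ k (product ts) (prodComm k cs)
  even-product-of-commutators []           _    = [] , λ _ → refl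
  even-product-of-commutators (_ ∷ [])     ()
  even-product-of-commutators (s ∷ t ∷ ts) even = (toΣ* s , conjugator s t) ∷ cs , pointwise
    where
    IH = even-product-of-commutators ts (trans (sym (opposite-involutive (-1^ length ts))) even)
    cs = proj₁ IH
    pointwise : _≈*_ k (product (s ∷ t ∷ ts)) (prodComm k ((toΣ* s , conjugator s t) ∷ cs))
    pointwise x = trans (cong (app k (_∘*_ k (toΣ* s) (toΣ* t))) (proj₂ IH x))
                        (sym (commutator-conjugator s t (app k (prodComm k cs) x)))

  sgn≡plus⇒commutators : ∀ r (σ : Σ* k r) → sgn k σ ≡ plus →
    Σ (List (Σ* k r × Σ* k r)) λ cs → _≈*_ k σ (prodComm k cs)
  sgn≡plus⇒commutators r σ sgnσ≡+ = cs , λ x → trans (σ≈ts x) (proj₂ commutators x)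
    where
    decomposition = decompose (allVecs k r) σ (λ x x∉ → ⊥-elim (x∉ (allVecs-complete r x)))
    ts = proj₁ decomposition
    σ≈ts = proj₂ decomposition
    even : -1^ length ts ≡ plus
    even = trans (sym (sgn-product ts)) (trans (sgn-≈ {σ = product ts} {τ = σ} (λ x → sym (σ≈ts x))) sgnσ≡+)
    commutators = even-product-of-commutators ts even
    cs = proj₁ commutators

open import Data.Sign using (Sign; _*_) renaming (+ to plus; - to minus)

mainTheorem5 : ∀ {q : ℕ} (k : FiniteField q) → q % 2 ≡ 1 →
    -- sgn is compatible with the transition maps i_r
    ((r : ℕ) (σ : Σ* k r) → sgn k (i k r σ) ≡ sgn k σ)
    -- the induced map Σ*_{q^∞} → {±1} is a group homomorphism
    × ((r : ℕ) (σ τ : Σ* k r) → sgn k (_∘*_ k σ τ) ≡ sgn k σ * sgn k τ)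
    -- it is surjective
    × (Σ ℕ λ r → Σ (Σ* k r) λ σ → sgn k σ ≡ minus)
    -- its kernel is contained in the commutator subgroup of Σ*_{q^∞}
    -- (so it induces an isomorphism from the abelianisation K_1 onto {±1})
    × ((r : ℕ) (σ : Σ* k r) → sgn k σ ≡ plus →
        Σ ℕ λ n → Σ (List (Σ* k (n + r) × Σ* k (n + r))) λ cs →
          _≈*_ k (lift k n σ) (prodComm k cs))
mainTheorem5 k q-odd =
    sgn-i q-odd
  , (λ _ → sgn-∘)
  , sgn-surjective q-odd
  -- Commutators at level r already suffice: no stabilisation along i is needed.
  , λ r σ sgnσ≡+ → 0 , sgn≡plus⇒commutators r σ sgnσ≡+
  where
  open Σ*Sign k
  open KernelOfSgn k
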